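{- Let $G=(V,E)$ be an undirected graph with $n$ vertices, $T\subseteq V$ a terminal set, $k$ a positive integer, and $(L,S,R)$ a vertex cut of $G$ with $T\cap L\neq\emptyset$ and $T\cap R\neq\emptyset$. Let $T_L=T\cap L$ and $T_R=T\cap R$. Let $G_L$ be the $k$-left graph and $G_R$ the $k$-right graph of $G$ with respect to $(L,S,R)$, with designated vertices $t_R$ and $t_L$ respectively. If $\kappa_G(T)<k$, then $\min\{\kappa_G(S),\ \kappa_{G_L}(T_L\cup\{t_R\}),\ \kappa_{G_R}(T_R\cup\{t_L\})\}<k$.
   Context: A vertex cut $(L,S,R)$ is a partition of $V$ with no edge between $L$ and $R$. For vertices $u,v$ of a graph $H$, $\kappa_H(u,v)$ is the minimum number of vertices whose removal separates $u$ from $v$ (or $|V(H)|-1$ if impossible), and for $X\subseteq V(H)$, $\kappa_H(X)=\min_{x,y\in X}\kappa_H(x,y)$, with $\kappa_H(X)=|V(H)|-1$ if $|X|\le1$. The $k$-left graph $G_L$ w.r.t. $(L,S,R)$ is obtained from $G$ by replacing $R$ with a clique $K_R$ on $k$ vertices, one of which is a designated terminal $t_R$, and adding all edges between $S$ and $K_R$; optionally all edges with both endpoints in $S$ are removed. The $k$-right graph $G_R$ is defined symmetrically, replacing $L$ with a $k$-clique $K_L$ containing a designated terminal $t_L$ and adding all edges between $S$ and $K_L$. -}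

module Defs where

open import Data.Nat using (ℕ; zero; suc; _+_; _∸_; _≤_; _<_)
open import Data.Fin using (Fin; splitAt; _↑ʳ_; fromℕ<; _≟_)
open import Data.Fin.Subset using (Subset; _∈_; _∉_; _⊆_; ∣_∣; ⊤)
open import Data.Vec using (tabulate; lookup)
open import Data.Bool using (Bool; true; false; _∧_; not)
open import Data.Sum using (_⊎_; inj₁; inj₂; [_,_])
open import Data.Product using (Σ; Σ-syntax; _×_; _,_; ∃; ∃-syntax)
open import Relation.Binary.PropositionalEquality using (_≡_; _≢_)
open import Relation.Nullary using (¬_)
open import Relation.Nullary.Decidable using (⌊_⌋)

record Graph (n : ℕ) : Set₁ where
  field
    Adj    : Fin n → Fin n → Set
    sym    : ∀ {u v} → Adj u v → Adj v u
    irrefl : ∀ {u} → ¬ Adj u u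

-- A graph whose vertex set is the subset V of Fin N (vertices outside V
-- are ignored: they never occur on walks, nor are counted).
record FGraph : Set₁ where
  field
    N : ℕ
    V : Subset N
    E : Fin N → Fin N → Set

data Part : Set where
  left sep right : Part

eqPart : Part → Part → Bool
eqPart left  left  = true
eqPart sep   sep   = true
eqPart right right = true
eqPart _     _     = false

record VertexCut {n : ℕ} (G : Graph n) : Set where
  field
    side   : Fin n → Part
    noEdge : ∀ u v → side u ≡ left → side v ≡ right → ¬ Graph.Adj G u v

asF : ∀ {n} → Graph n → FGraph
asF {n} G = record { N = n ; V = ⊤ ; E = Graph.Adj G }

data Reach (H : FGraph) (Z : Subset (FGraph.N H)) :
           Fin (FGraph.N H) → Fin (FGraph.N H) → Set where
  here : ∀ {u} → u ∈ FGraph.V H → u ∉ Z → Reach H Z u u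
  step : ∀ {u w v} → Reach H Z u w → FGraph.E H w v →
         v ∈ FGraph.V H → v ∉ Z → Reach H Z u v

module _ (H : FGraph) where
  open FGraph H

  Separates : Subset N → Fin N → Fin N → Set
  Separates Z u v = Z ⊆ V × u ∉ Z × v ∉ Z × ¬ Reach H Z u v

  IsκPair : Fin N → Fin N → ℕ → Set
  IsκPair u v m =
      (Σ[ Z ∈ Subset N ] (Separates Z u v × ∣ Z ∣ ≡ m ×
          (∀ Z' → Separates Z' u v → m ≤ ∣ Z' ∣)))
    ⊎ ((∀ Z → ¬ Separates Z u v) × m ≡ ∣ V ∣ ∸ 1)

  IsκSet : Subset N → ℕ → Set
  IsκSet X m =
      (∣ X ∣ ≤ 1 × m ≡ ∣ V ∣ ∸ 1)
    ⊎ (1 < ∣ X ∣ ×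
       (Σ[ x ∈ Fin N ] Σ[ y ∈ Fin N ] (x ∈ X × y ∈ X × x ≢ y × IsκPair x y m)) ×
       (∀ x y m' → x ∈ X → y ∈ X → x ≢ y → IsκPair x y m' → m ≤ m'))

-- Replacing the part X (= right for the k-left graph, = left for the
-- k-right graph) by a k-clique fully joined to S.  Vertex set lives in
-- Fin (n + k): the first n indices are the original vertices (those in X
-- are removed), the last k indices are the clique.
module _ {n : ℕ} (G : Graph n) (C : VertexCut G) (k : ℕ) (dropSS : Bool) (X : Part) where
  open Graph G
  open VertexCut C

  replE : Fin n ⊎ Fin k → Fin n ⊎ Fin k → Set
  replE (inj₁ u) (inj₁ v) = Adj u v × (dropSS ≡ true → ¬ (side u ≡ sep × side v ≡ sep))
  replE (inj₁ u) (inj₂ _) = side u ≡ sep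
  replE (inj₂ _) (inj₁ v) = side v ≡ sep
  replE (inj₂ a) (inj₂ b) = a ≢ b

  replace : FGraph
  replace = record
    { N = n + k
    ; V = tabulate (λ i → [ (λ v → not (eqPart (side v) X)) , (λ _ → true) ] (splitAt n i))
    ; E = λ i j → replE (splitAt n i) (splitAt n j)
    }

  -- (T ∩ Y) ∪ {t}, where Y is the part opposite to X and t is the
  -- designated clique vertex.
  termSet : Subset n → Part → Fin k → Subset (n + k)
  termSet T Y t = tabulate (λ i →
    [ (λ v → lookup T v ∧ eqPart (side v) Y) , (λ a → ⌊ a ≟ t ⌋) ] (splitAt n i))

kLeft kRight : ∀ {n} (G : Graph n) → VertexCut G → ℕ → Bool → FGraph
kLeft  G C k d = replace G C k d right
kRight G C k d = replace G C k d left

sepSet : ∀ {n} {G : Graph n} → VertexCut G → Subset n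
sepSet C = tabulate (λ v → eqPart (VertexCut.side C v) sep)

-- Take a smallest separator Z of two terminals x, y ∈ T. An endpoint lying in L either
-- reaches S in G − Z, or it cannot, and then Z ∖ R (which survives in G_L) already
-- separates it from t_R; symmetrically on the right. If both endpoints reach S, at
-- s_x and s_y say, then Z separates s_x from s_y, since otherwise x would reach y. In
-- every case one of κ_G(S), κ_{G_L}(T_L ∪ {t_R}), κ_{G_R}(T_R ∪ {t_L}) is at most ∣Z∣ = κ_G(T).
-- Reachability is not decidable here, so the case split happens under ¬¬, which is
-- harmless because the conclusion is a decidable inequality.
module Submission where

open import Defs
open import Level using (Level; _⊔_)
open import Data.Bool using (Bool; true; _∧_)
open import Data.Empty using (⊥-elim)
open import Data.Nat using (ℕ; suc; _+_; _∸_; _≤_; _<_; _⊓_; _≤?_)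
open import Data.Nat.Induction using (<-wellFounded)
open import Data.Nat.Properties using (≤-refl; ≤-reflexive; ≤-trans; ≤-<-trans; <⇒≤; <⇒≱; ≮⇒≥; <⇒≤pred; m⊓n≤m; m⊓n≤n; +-identityʳ)
open import Data.Fin using (Fin; fromℕ<; splitAt; _↑ˡ_; _↑ʳ_; _≟_)
open import Data.Fin.Properties using (splitAt-↑ˡ; splitAt-↑ʳ; splitAt⁻¹-↑ˡ; splitAt⁻¹-↑ʳ)
open import Data.Fin.Subset using (Subset; _∈_; _∉_; ∣_∣; ⊥; ⁅_⁆; _∩_; inside; outside)
open import Data.Fin.Subset.Properties using (∈⊤; ∉⊥; ∣⊤∣≡n; ∣⊥∣≡0; ∣⁅x⁆∣≡1; x∈⁅y⁆⇒x≡y; p⊂q⇒∣p∣<∣q∣; p∩q⊆q; ∣p∩q∣≤∣p∣; x∈p∩q⁺; x∈p∩q⁻)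
open import Data.Vec using (_∷_; []; _++_; tabulate; lookup)
open import Data.Vec.Properties using (lookup-++ˡ; lookup-++ʳ; lookup∘tabulate; []=⇒lookup; lookup⇒[]=)
open import Data.Sum using (_⊎_; inj₁; inj₂; [_,_]′; map₁)
open import Data.Product using (Σ-syntax; ∃-syntax; _×_; _,_; proj₁; proj₂)
open import Function using (_∘_; _on_)
open import Effect.Monad using (RawMonad)
open import Induction.WellFounded using (WfRec; module All)
open import Relation.Binary.Construct.On using (wellFounded)
open import Relation.Binary.PropositionalEquality using (_≡_; _≢_; refl; sym; trans; cong; cong₂; subst; subst₂)
open import Relation.Nullary using (¬_; yes; no)
open import Relation.Nullary.Negation using (¬¬-Monad; ¬¬-map)
open import Relation.Nullary.Decidable using (decidable-stable; ¬¬-excluded-middle; dec-true; isYes≗does)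

private
  variable
    a p : Level
    m k : ℕ

m⊓n⊓o≤m : ∀ m n o → m ⊓ n ⊓ o ≤ m
m⊓n⊓o≤m m n o = ≤-trans (m⊓n≤m (m ⊓ n) o) (m⊓n≤m m n)

m⊓n⊓o≤n : ∀ m n o → m ⊓ n ⊓ o ≤ n
m⊓n⊓o≤n m n o = ≤-trans (m⊓n≤m (m ⊓ n) o) (m⊓n≤n m n)

m⊓n⊓o≤o : ∀ m n o → m ⊓ n ⊓ o ≤ o
m⊓n⊓o≤o m n o = m⊓n≤n (m ⊓ n) o

↑ˡ≢↑ʳ : ∀ {i : Fin m} {j : Fin k} → i ↑ˡ k ≢ m ↑ʳ j
↑ˡ≢↑ʳ {m} {k} {i} {j} eq
  with () ← trans (sym (splitAt-↑ˡ m i k)) (trans (cong (splitAt m) eq) (splitAt-↑ʳ m k j))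

∈-tabulate⁺ : ∀ {f : Fin m → Bool} {i} → f i ≡ true → i ∈ tabulate f
∈-tabulate⁺ {f = f} {i} fi = lookup⇒[]= i _ (trans (lookup∘tabulate f i) fi)

module _ {n} {f : Fin n → Bool} {g : Fin k → Bool} where

  ↑ˡ∈tabulate-splitAt : ∀ {i} → f i ≡ true → i ↑ˡ k ∈ tabulate ([ f , g ]′ ∘ splitAt n)
  ↑ˡ∈tabulate-splitAt {i} fi = ∈-tabulate⁺ (trans (cong [ f , g ]′ (splitAt-↑ˡ n i k)) fi)

  ↑ʳ∈tabulate-splitAt : ∀ {j} → g j ≡ true → n ↑ʳ j ∈ tabulate ([ f , g ]′ ∘ splitAt n)
  ↑ʳ∈tabulate-splitAt {j} gj = ∈-tabulate⁺ (trans (cong [ f , g ]′ (splitAt-↑ʳ n k j)) gj)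

∈-resp-lookup : ∀ {n} {p : Subset m} {q : Subset n} {i j} → lookup q j ≡ lookup p i → i ∈ p → j ∈ q
∈-resp-lookup eq i∈p = lookup⇒[]= _ _ (trans eq ([]=⇒lookup i∈p))

module _ {n} {p : Subset m} {q : Subset n} where

  x∈p⇒x↑ˡ∈p++q : ∀ {x} → x ∈ p → x ↑ˡ n ∈ p ++ q
  x∈p⇒x↑ˡ∈p++q {x} = ∈-resp-lookup (lookup-++ˡ p q x)

  x↑ˡ∈p++q⇒x∈p : ∀ {x} → x ↑ˡ n ∈ p ++ q → x ∈ p
  x↑ˡ∈p++q⇒x∈p {x} = ∈-resp-lookup (sym (lookup-++ˡ p q x))

  x↑ʳ∈p++q⇒x∈q : ∀ {x} → m ↑ʳ x ∈ p ++ q → x ∈ q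
  x↑ʳ∈p++q⇒x∈q {x} = ∈-resp-lookup (sym (lookup-++ʳ p q x))

∣p++q∣≡∣p∣+∣q∣ : ∀ {n} (p : Subset m) (q : Subset n) → ∣ p ++ q ∣ ≡ ∣ p ∣ + ∣ q ∣
∣p++q∣≡∣p∣+∣q∣ []            q = refl
∣p++q∣≡∣p∣+∣q∣ (inside ∷ p)  q = cong suc (∣p++q∣≡∣p∣+∣q∣ p q)
∣p++q∣≡∣p∣+∣q∣ (outside ∷ p) q = ∣p++q∣≡∣p∣+∣q∣ p q

x∈p∧y∈p∧x≢y⇒1<∣p∣ : ∀ {p : Subset m} {x y} → x ∈ p → y ∈ p → x ≢ y → 1 < ∣ p ∣
x∈p∧y∈p∧x≢y⇒1<∣p∣ {p = p} {x} {y} x∈p y∈p x≢y =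
  subst (_< ∣ p ∣) (∣⁅x⁆∣≡1 x) (p⊂q⇒∣p∣<∣q∣ (⁅x⁆⊆p , y , y∈p , x≢y ∘ sym ∘ x∈⁅y⁆⇒x≡y x))
  where
  ⁅x⁆⊆p : ∀ {z} → z ∈ ⁅ x ⁆ → z ∈ p
  ⁅x⁆⊆p z∈⁅x⁆ = subst (_∈ p) (sym (x∈⁅y⁆⇒x≡y x z∈⁅x⁆)) x∈p

x∉p⇒∣p∣<n : ∀ {p : Subset m} {x} → x ∉ p → ∣ p ∣ < m
x∉p⇒∣p∣<n {m} {p} {x} x∉p = subst (∣ p ∣ <_) (∣⊤∣≡n m) (p⊂q⇒∣p∣<∣q∣ ((λ _ → ∈⊤) , x , ∈⊤ , x∉p))

¬¬-minimal : ∀ {A : Set a} (P : A → Set p) (f : A → ℕ) {x} → P x →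
             ¬ ¬ (Σ[ y ∈ A ] (P y × f y ≤ f x × (∀ z → P z → f y ≤ f z)))
¬¬-minimal {a} {p} {A} P f {x} = All.wfRec (wellFounded f <-wellFounded) (a ⊔ p) Motive descend x
  where
  open RawMonad ¬¬-Monad
  Motive : A → Set (a ⊔ p)
  Motive x = P x → ¬ ¬ (Σ[ y ∈ A ] (P y × f y ≤ f x × (∀ z → P z → f y ≤ f z)))
  descend : ∀ x → WfRec (_<_ on f) Motive x → Motive x
  descend x smaller px = ¬¬-excluded-middle {A = Σ[ z ∈ A ] (P z × f z < f x)} >>= λ where
    (yes (z , pz , fz<fx)) →
      ¬¬-map (λ (y , py , fy≤fz , min) → y , py , ≤-trans fy≤fz (<⇒≤ fz<fx) , min) (smaller fz<fx pz)
    (no ∄smaller) → pure (x , px , ≤-refl , λ z pz → ≮⇒≥ (λ fz<fx → ∄smaller (z , pz , fz<fx)))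

module _ (H : FGraph) where
  open FGraph H

  Reach-end : ∀ {Z u v} → Reach H Z u v → v ∈ V × v ∉ Z
  Reach-end (here v∈V v∉Z)     = v∈V , v∉Z
  Reach-end (step _ _ v∈V v∉Z) = v∈V , v∉Z

  Reach-trans : ∀ {Z u w v} → Reach H Z u w → Reach H Z w v → Reach H Z u v
  Reach-trans r (here _ _)          = r
  Reach-trans r (step r′ e v∈V v∉Z) = step (Reach-trans r r′) e v∈V v∉Z

  Reach-sym : (∀ {u v} → E u v → E v u) → ∀ {Z u v} → Reach H Z u v → Reach H Z v u
  Reach-sym E-sym (here v∈V v∉Z)     = here v∈V v∉Z
  Reach-sym E-sym (step r e v∈V v∉Z) =
    Reach-trans (step (here v∈V v∉Z) (E-sym e) (proj₁ (Reach-end r)) (proj₂ (Reach-end r))) (Reach-sym E-sym r)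

  IsκPair-exists : ∀ {Z x y} → Separates H Z x y → ¬ ¬ (Σ[ m ∈ ℕ ] (IsκPair H x y m × m ≤ ∣ Z ∣))
  IsκPair-exists Z-sep = ¬¬-map
    (λ (Z₀ , Z₀-sep , ∣Z₀∣≤∣Z∣ , Z₀-min) → ∣ Z₀ ∣ , inj₁ (Z₀ , Z₀-sep , refl , Z₀-min) , ∣Z₀∣≤∣Z∣)
    (¬¬-minimal (λ Z → Separates H Z _ _) ∣_∣ Z-sep)

  IsκSet≤separator : ∀ {X m x y Z} → IsκSet H X m → x ∈ X → y ∈ X → x ≢ y →
                     Separates H Z x y → m ≤ ∣ Z ∣
  IsκSet≤separator (inj₁ (∣X∣≤1 , _)) x∈X y∈X x≢y _ = ⊥-elim (<⇒≱ (x∈p∧y∈p∧x≢y⇒1<∣p∣ x∈X y∈X x≢y) ∣X∣≤1)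
  IsκSet≤separator {m = m} {Z = Z} (inj₂ (_ , _ , minimal)) x∈X y∈X x≢y Z-sep =
    decidable-stable (m ≤? ∣ Z ∣)
      (¬¬-map (λ (m′ , κ , m′≤∣Z∣) → ≤-trans (minimal _ _ m′ x∈X y∈X x≢y κ) m′≤∣Z∣) (IsκPair-exists Z-sep))

  IsκSet-attained : ∀ {X m} → IsκSet H X m →
    m ≡ ∣ V ∣ ∸ 1 ⊎ ∃[ x ] ∃[ y ] ∃[ Z ] (x ∈ X × y ∈ X × Separates H Z x y × ∣ Z ∣ ≡ m)
  IsκSet-attained (inj₁ (_ , m≡)) = inj₁ m≡
  IsκSet-attained (inj₂ (_ , (x , y , x∈X , y∈X , _ , inj₁ (Z , Z-sep , ∣Z∣≡m , _)) , _)) =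
    inj₂ (x , y , Z , x∈X , y∈X , Z-sep , ∣Z∣≡m)
  IsκSet-attained (inj₂ (_ , (_ , _ , _ , _ , _ , inj₂ (_ , m≡)) , _)) = inj₁ m≡

IsκSet-asF≤ : ∀ {n} (G : Graph n) {X m} → IsκSet (asF G) X m → m ≤ n ∸ 1
IsκSet-asF≤ {n} G κ with IsκSet-attained (asF G) κ
... | inj₁ m≡ = ≤-reflexive (trans m≡ (cong (_∸ 1) (∣⊤∣≡n n)))
... | inj₂ (_ , _ , _ , _ , _ , (_ , x∉Z , _) , ∣Z∣≡m) = subst (_≤ n ∸ 1) ∣Z∣≡m (<⇒≤pred (x∉p⇒∣p∣<n x∉Z))

eqPart-refl : ∀ P → eqPart P P ≡ true
eqPart-refl left  = refl
eqPart-refl sep   = refl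
eqPart-refl right = refl

module _ {n} (G : Graph n) (C : VertexCut G) where
  open VertexCut C

  ReachesSeparator : Subset n → Fin n → Set
  ReachesSeparator Z x = Σ[ s ∈ Fin n ] (side s ≡ sep × Reach (asF G) Z x s)

  κS≤separator : ∀ {κS Z x y} → IsκSet (asF G) (sepSet C) κS → Separates (asF G) Z x y →
                 ReachesSeparator Z x → ReachesSeparator Z y → κS ≤ ∣ Z ∣
  κS≤separator {Z = Z} {x} {y} isS (Z⊆V , _ , _ , x↛y) (s , s∈S , x→s) (t , t∈S , y→t) =
    IsκSet≤separator (asF G) isS (∈sepSet s∈S) (∈sepSet t∈S) s≢t
      (Z⊆V , proj₂ (Reach-end (asF G) x→s) , proj₂ (Reach-end (asF G) y→t) , x↛y ∘ through)
    where
    ∈sepSet : ∀ {v} → side v ≡ sep → v ∈ sepSet C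
    ∈sepSet v∈S = ∈-tabulate⁺ (cong (λ P → eqPart P sep) v∈S)
    through : Reach (asF G) Z s t → Reach (asF G) Z x y
    through s→t = Reach-trans (asF G) x→s (Reach-trans (asF G) s→t (Reach-sym (asF G) (Graph.sym G) y→t))
    s≢t : s ≢ t
    s≢t refl = x↛y (through (here ∈⊤ (proj₂ (Reach-end (asF G) x→s))))

  module _ (k : ℕ) (d : Bool) (X : Part) where
    private
      H = replace G C k d X

    data Vertex : Fin (n + k) → Set where
      original : ∀ v → Vertex (v ↑ˡ k)
      clique   : ∀ c → Vertex (n ↑ʳ c)

    vertex : ∀ i → Vertex i
    vertex i with splitAt n i in eq
    ... | inj₁ v = subst Vertex (splitAt⁻¹-↑ˡ eq) (original v)
    ... | inj₂ c = subst Vertex (splitAt⁻¹-↑ʳ eq) (clique c)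

    E-original : ∀ {u v} → FGraph.E H (u ↑ˡ k) (v ↑ˡ k) → Graph.Adj G u v
    E-original {u} {v} e = proj₁ (subst₂ (replE G C k d X) (splitAt-↑ˡ n u k) (splitAt-↑ˡ n v k) e)

    E-clique : ∀ {u c} → FGraph.E H (u ↑ˡ k) (n ↑ʳ c) → side u ≡ sep
    E-clique {u} {c} e = subst₂ (replE G C k d X) (splitAt-↑ˡ n u k) (splitAt-↑ʳ n k c) e

    lift : Subset n → Subset (n + k)
    lift Z = (Z ++ ⊥) ∩ FGraph.V H

    ∣lift∣≤ : ∀ Z → ∣ lift Z ∣ ≤ ∣ Z ∣
    ∣lift∣≤ Z = ≤-trans (∣p∩q∣≤∣p∣ (Z ++ ⊥) _)
      (≤-reflexive (trans (∣p++q∣≡∣p∣+∣q∣ Z ⊥) (trans (cong (∣ Z ∣ +_) (∣⊥∣≡0 k)) (+-identityʳ ∣ Z ∣))))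

    ∉lift⇒∉ : ∀ {Z v} → v ↑ˡ k ∈ FGraph.V H → v ↑ˡ k ∉ lift Z → v ∉ Z
    ∉lift⇒∉ v∈V v∉Z′ v∈Z = v∉Z′ (x∈p∩q⁺ (x∈p⇒x↑ˡ∈p++q v∈Z , v∈V))

    Reach-lift⁻ : ∀ {Z x j} → Reach H (lift Z) (x ↑ˡ k) j →
                  ReachesSeparator Z x ⊎ ∃[ v ] (v ↑ˡ k ≡ j × Reach (asF G) Z x v)
    Reach-lift⁻ (here x∈V x∉Z′) = inj₂ (_ , refl , here ∈⊤ (∉lift⇒∉ x∈V x∉Z′))
    Reach-lift⁻ (step {v = j} r e j∈V j∉Z′) with Reach-lift⁻ r
    ... | inj₁ x→S = inj₁ x→S
    ... | inj₂ (w , refl , x→w) with vertex j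
    ...   | original v = inj₂ (v , refl , step x→w (E-original e) ∈⊤ (∉lift⇒∉ j∈V j∉Z′))
    ...   | clique _   = inj₁ (w , E-clique e , x→w)

    lift-separates : ∀ {Z x c} → x ∉ Z → ¬ ReachesSeparator Z x → Separates H (lift Z) (x ↑ˡ k) (n ↑ʳ c)
    lift-separates {Z} {x} {c} x∉Z x↛S = p∩q⊆q (Z ++ ⊥) _ , x∉Z′ , c∉Z′ , reaches-clique
      where
      x∉Z′ : x ↑ˡ k ∉ lift Z
      x∉Z′ = x∉Z ∘ x↑ˡ∈p++q⇒x∈p ∘ proj₁ ∘ x∈p∩q⁻ (Z ++ ⊥) _
      c∉Z′ : n ↑ʳ c ∉ lift Z
      c∉Z′ = ∉⊥ ∘ x↑ʳ∈p++q⇒x∈q {p = Z} ∘ proj₁ ∘ x∈p∩q⁻ (Z ++ ⊥) _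
      reaches-clique : ¬ Reach H (lift Z) (x ↑ˡ k) (n ↑ʳ c)
      reaches-clique r with Reach-lift⁻ r
      ... | inj₁ x→S          = x↛S x→S
      ... | inj₂ (_ , eq , _) = ↑ˡ≢↑ʳ eq

    κ≤separator⊎ReachesSeparator :
      ∀ {T Y c κ Z x} → IsκSet H (termSet G C k d X T Y c) κ → x ∈ T → side x ≡ Y → x ∉ Z →
      ¬ ¬ (κ ≤ ∣ Z ∣ ⊎ ReachesSeparator Z x)
    κ≤separator⊎ReachesSeparator {T} {Y} {c} {Z = Z} {x} isκ x∈T x∈Y x∉Z =
      ¬¬-map (λ where
        (yes x→S) → inj₂ x→S
        (no x↛S)  → inj₁ (≤-trans (IsκSet≤separator H isκ x∈T′ c∈T′ ↑ˡ≢↑ʳ (lift-separates x∉Z x↛S)) (∣lift∣≤ Z)))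
        ¬¬-excluded-middle
      where
      x∈T′ : x ↑ˡ k ∈ termSet G C k d X T Y c
      x∈T′ = ↑ˡ∈tabulate-splitAt (cong₂ _∧_ ([]=⇒lookup x∈T) (subst (λ P → eqPart P Y ≡ true) (sym x∈Y) (eqPart-refl Y)))
      c∈T′ : n ↑ʳ c ∈ termSet G C k d X T Y c
      c∈T′ = ↑ʳ∈tabulate-splitAt {n = n} (trans (isYes≗does (c ≟ c)) (dec-true (c ≟ c) refl))

  min≤separator :
    ∀ {T k dL dR cL cR κS κL κR Z x y} →
    IsκSet (asF G) (sepSet C) κS →
    IsκSet (kLeft G C k dL) (termSet G C k dL right T left cL) κL →
    IsκSet (kRight G C k dR) (termSet G C k dR left T right cR) κR →
    x ∈ T → y ∈ T → Separates (asF G) Z x y →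
    ¬ ¬ (κS ⊓ κL ⊓ κR ≤ ∣ Z ∣)
  min≤separator {T} {k} {dL} {dR} {κS = κS} {κL} {κR} {Z} isS isL isR x∈T y∈T Z-sep@(_ , x∉Z , y∉Z , _) = do
    x-done ← endpoint x∈T x∉Z
    y-done ← endpoint y∈T y∉Z
    pure (both x-done y-done)
    where
    open RawMonad ¬¬-Monad
    Done : Fin n → Set
    Done w = κS ⊓ κL ⊓ κR ≤ ∣ Z ∣ ⊎ ReachesSeparator Z w

    endpoint : ∀ {w} → w ∈ T → w ∉ Z → ¬ ¬ Done w
    endpoint {w} w∈T w∉Z with side w in w∈P
    ... | left  = ¬¬-map (map₁ (≤-trans (m⊓n⊓o≤n κS κL κR)))
                    (κ≤separator⊎ReachesSeparator k dL right isL w∈T w∈P w∉Z)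
    ... | sep   = pure (inj₂ (w , w∈P , here ∈⊤ w∉Z))
    ... | right = ¬¬-map (map₁ (≤-trans (m⊓n⊓o≤o κS κL κR)))
                    (κ≤separator⊎ReachesSeparator k dR left isR w∈T w∈P w∉Z)

    both : Done _ → Done _ → κS ⊓ κL ⊓ κR ≤ ∣ Z ∣
    both (inj₁ min≤∣Z∣) _              = min≤∣Z∣
    both (inj₂ _)        (inj₁ min≤∣Z∣) = min≤∣Z∣
    both (inj₂ x→S)      (inj₂ y→S)     = ≤-trans (m⊓n⊓o≤m κS κL κR) (κS≤separator isS Z-sep x→S y→S)

lemma3p7 : ∀ {n : ℕ} (G : Graph n) (T : Subset n) (k : ℕ) (k>0 : 0 < k)
    (C : VertexCut G) →
    (Σ[ t ∈ Fin n ] (t ∈ T × VertexCut.side C t ≡ left)) →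
    (Σ[ t ∈ Fin n ] (t ∈ T × VertexCut.side C t ≡ right)) →
    (dropL dropR : Bool) →
    (κT κS κL κR : ℕ) →
    IsκSet (asF G) T κT →
    IsκSet (asF G) (sepSet C) κS →
    IsκSet (kLeft G C k dropL) (termSet G C k dropL right T left (fromℕ< k>0)) κL →
    IsκSet (kRight G C k dropR) (termSet G C k dropR left T right (fromℕ< k>0)) κR →
    κT < k →
    κS ⊓ κL ⊓ κR < k
lemma3p7 {n} G T k k>0 C _ _ _ _ κT κS κL κR isT isS isL isR κT<k
  with IsκSet-attained (asF G) isT
... | inj₁ κT≡∣V∣∸1 =
  ≤-<-trans (≤-trans (m⊓n⊓o≤m κS κL κR) (IsκSet-asF≤ G isS))
            (subst (_< k) (trans κT≡∣V∣∸1 (cong (_∸ 1) (∣⊤∣≡n n))) κT<k)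
... | inj₂ (_ , _ , Z , x∈T , y∈T , Z-sep , ∣Z∣≡κT) =
  ≤-<-trans (decidable-stable (_ ≤? ∣ Z ∣) (min≤separator G C isS isL isR x∈T y∈T Z-sep))
            (subst (_< k) (sym ∣Z∣≡κT) κT<k)
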